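{- Let $G$ be a finite simple graph with vertices numbered $1,\dots,n$, let $X$ be a solution, let $Y$ be a child of $X$ (i.e. $\mathrm{Par}(Y)=X$), and let $v=pv(Y)$. Then $WS(Y)=(WS(X)\setminus \mathrm{Del}_{WS}(X,v))\cup\{v\}$.
   Context: For $S\subseteq V$, $N_S(u)=N(u)\cap S$; in $G[S]$, $a,b$ are comparable if $N_S(a)\subseteq N_S(b)$ or $N_S(b)\subseteq N_S(a)$; $u\in S$ is weak-simplicial in $G[S]$ if $N_S(u)$ is independent and any two vertices of $N_S(u)$ are comparable in $G[S]$. A solution is $X\subseteq V$ with $G[X]$ chordal bipartite (bipartite, no induced cycle of length $\ge6$). $WS(X)$ is the set of weak-simplicial vertices of $G[X]$; for nonempty $X$, $pv(X)=\max WS(X)$ and $\mathrm{Par}(X)=X\setminus\{pv(X)\}$. $N^{1:2}(v)$ is the set of vertices at distance $1$ or $2$ from $v$ in $G$. $\mathrm{Del}_{WS}(X,v)=\{u\in N^{1:2}(v)\cap WS(X): u\notin WS(X\cup\{v\})\}$. -}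

module Defs where

open import Data.Nat using (ℕ; zero; suc; _≤_)
open import Data.Bool using (Bool; true; false)
open import Data.Fin using (Fin; toℕ) renaming (_≤_ to _≤ᶠ_)
open import Data.Fin.Subset using (Subset; _∈_; _∉_; _∪_; _-_; ⁅_⁆)
open import Data.Product using (Σ; ∃; _×_; _,_)
open import Data.Sum using (_⊎_)
open import Function using (Injective)
open import Relation.Nullary using (¬_)
open import Relation.Binary.PropositionalEquality using (_≡_; _≢_)

-- A finite simple graph on the vertex set Fin n (vertices numbered 0..n-1,
-- corresponding to 1..n in the paper, with the same order).
record Graph (n : ℕ) : Set where
  field
    adj   : Fin n → Fin n → Bool
    sym   : ∀ u v → adj u v ≡ adj v u
    irrefl : ∀ u → adj u u ≡ false

module _ {n : ℕ} (G : Graph n) where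
  open Graph G

  Adj : Fin n → Fin n → Set
  Adj u v = adj u v ≡ true

  NbSub : Subset n → Fin n → Fin n → Set
  NbSub S a b = ∀ x → x ∈ S → Adj a x → Adj b x

  Comparable : Subset n → Fin n → Fin n → Set
  Comparable S a b = NbSub S a b ⊎ NbSub S b a

  WeakSimplicial : Subset n → Fin n → Set
  WeakSimplicial S u =
    u ∈ S
    × (∀ a b → a ∈ S → b ∈ S → Adj u a → Adj u b → ¬ Adj a b)
    × (∀ a b → a ∈ S → b ∈ S → Adj u a → Adj u b → Comparable S a b)

  Bipartite : Subset n → Set
  Bipartite S = Σ (Fin n → Bool) λ col →
    ∀ u v → u ∈ S → v ∈ S → Adj u v → col u ≢ col v

  CycAdj : (k : ℕ) → Fin k → Fin k → Set
  CycAdj k i j =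
    suc (toℕ i) ≡ toℕ j ⊎ suc (toℕ j) ≡ toℕ i
    ⊎ (toℕ i ≡ 0 × suc (toℕ j) ≡ k) ⊎ (toℕ j ≡ 0 × suc (toℕ i) ≡ k)

  InducedCycle : Subset n → (k : ℕ) → (Fin k → Fin n) → Set
  InducedCycle S k c =
    Injective _≡_ _≡_ c
    × (∀ i → c i ∈ S)
    × (∀ i j → CycAdj k i j → Adj (c i) (c j))
    × (∀ i j → Adj (c i) (c j) → CycAdj k i j)

  ChordalBipartite : Subset n → Set
  ChordalBipartite S =
    Bipartite S × (∀ k (c : Fin k → Fin n) → 6 ≤ k → ¬ InducedCycle S k c)

  IsSolution : Subset n → Set
  IsSolution X = ChordalBipartite X

  IsPV : Subset n → Fin n → Set
  IsPV X v = WeakSimplicial X v × (∀ u → WeakSimplicial X u → u ≤ᶠ v)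

  Dist12 : Fin n → Fin n → Set
  Dist12 v u = Adj v u ⊎ (u ≢ v × ¬ Adj v u × ∃ λ w → Adj v w × Adj w u)

  DelWS : Subset n → Fin n → Fin n → Set
  DelWS X v u =
    Dist12 v u × WeakSimplicial X u × ¬ WeakSimplicial (X ∪ ⁅ v ⁆) u

module Submission where

open import Defs
open import Data.Nat using (ℕ)
open import Data.Fin using (Fin)
open import Data.Fin.Subset using (Subset; _-_)
open import Data.Product using (_×_)
open import Data.Sum using (_⊎_)
open import Function.Bundles using (_⇔_)
open import Relation.Nullary using (¬_)
open import Relation.Binary.PropositionalEquality using (_≡_)

open import Data.Bool using (true)
import Data.Bool.Properties as Bool
open import Data.Empty using (⊥-elim)
open import Data.Fin.Properties using (all?; _≟_)
open import Data.Fin.Subset using (_∈_; _∉_; _⊆_; _∪_; ⁅_⁆)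
open import Data.Fin.Subset.Properties
  using (_∈?_; x∈⁅x⁆; x∈⁅y⁆⇒x≡y; x∈p∪q⁺; x∈p∪q⁻; p─q⊆p; x∈p∧x≢y⇒x∈p-y)
open import Data.Product using (_,_; proj₁)
open import Data.Sum using (inj₁; inj₂)
open import Function.Bundles using (mk⇔)
open import Relation.Nullary using (Dec; yes; no; contradiction)
open import Relation.Nullary.Decidable using (_→-dec_; _×-dec_; _⊎-dec_; ¬?; decidable-stable)
open import Relation.Binary.PropositionalEquality using (refl; sym; trans; subst; _≢_)

-- Y = X ∪ {v} with v outside X. A vertex u ≠ v keeps its neighbourhood in G[X] when
-- v is added unless v is a neighbour of u or of one of u's neighbours, so away from
-- N^{1:2}(v) weak-simpliciality in X and in Y agree; inside N^{1:2}(v) the vertices of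
-- WS(X) that do not survive are by definition Del_WS(X, v), while v ∈ WS(Y) as pv(Y).

p⊆p-x∪⁅x⁆ : ∀ {n} (p : Subset n) (x : Fin n) → p ⊆ (p - x) ∪ ⁅ x ⁆
p⊆p-x∪⁅x⁆ p x {y} y∈p with y ≟ x
... | yes refl = x∈p∪q⁺ (inj₂ (x∈⁅x⁆ x))
... | no  y≢x  = x∈p∪q⁺ (inj₁ (x∈p∧x≢y⇒x∈p-y y∈p y≢x))

x∈p⇒p-x∪⁅x⁆⊆p : ∀ {n} {p : Subset n} {x : Fin n} → x ∈ p → (p - x) ∪ ⁅ x ⁆ ⊆ p
x∈p⇒p-x∪⁅x⁆⊆p {p = p} {x} x∈p y∈ with x∈p∪q⁻ (p - x) ⁅ x ⁆ y∈
... | inj₁ y∈p-x = p─q⊆p p ⁅ x ⁆ y∈p-x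
... | inj₂ y∈⁅x⁆ = subst (_∈ p) (sym (x∈⁅y⁆⇒x≡y x y∈⁅x⁆)) x∈p

x∈p∧x∉p-y⇒x≡y : ∀ {n} {p : Subset n} {x y : Fin n} → x ∈ p → x ∉ p - y → x ≡ y
x∈p∧x∉p-y⇒x≡y {x = x} {y} x∈p x∉p-y with x ≟ y
... | yes x≡y = x≡y
... | no  x≢y = contradiction (x∈p∧x≢y⇒x∈p-y x∈p x≢y) x∉p-y

module _ {n : ℕ} (G : Graph n) where

  Adj-sym : ∀ {a b} → Adj G a b → Adj G b a
  Adj-sym {a} {b} = trans (Graph.sym G b a)

  adj? : ∀ a b → Dec (Adj G a b)
  adj? a b = Graph.adj G a b Bool.≟ true

  nbSub? : ∀ S a b → Dec (NbSub G S a b)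
  nbSub? S a b = all? λ x → x ∈? S →-dec (adj? a x →-dec adj? b x)

  weakSimplicial? : ∀ S u → Dec (WeakSimplicial G S u)
  weakSimplicial? S u = u ∈? S ×-dec (independent? ×-dec comparable?)
    where
    onNeighbourPairs : (Fin n → Fin n → Set) → Set
    onNeighbourPairs P = ∀ a b → a ∈ S → b ∈ S → Adj G u a → Adj G u b → P a b
    pairs? : ∀ {P} → (∀ a b → Dec (P a b)) → Dec (onNeighbourPairs P)
    pairs? P? = all? λ a → all? λ b →
      a ∈? S →-dec (b ∈? S →-dec (adj? u a →-dec (adj? u b →-dec P? a b)))
    independent? : Dec (onNeighbourPairs λ a b → ¬ Adj G a b)
    independent? = pairs? λ a b → ¬? (adj? a b)
    comparable? : Dec (onNeighbourPairs (Comparable G S))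
    comparable? = pairs? λ a b → nbSub? S a b ⊎-dec nbSub? S b a

  NbSub-⊆ : ∀ {S T a b} → T ⊆ S → NbSub G S a b → NbSub G T a b
  NbSub-⊆ T⊆S a≤b x x∈T = a≤b x (T⊆S x∈T)

  Comparable-⊆ : ∀ {S T a b} → T ⊆ S → Comparable G S a b → Comparable G T a b
  Comparable-⊆ T⊆S (inj₁ a≤b) = inj₁ (NbSub-⊆ T⊆S a≤b)
  Comparable-⊆ T⊆S (inj₂ b≤a) = inj₂ (NbSub-⊆ T⊆S b≤a)

  WeakSimplicial-⊆ : ∀ {S T u} → T ⊆ S → u ∈ T → WeakSimplicial G S u → WeakSimplicial G T u
  WeakSimplicial-⊆ T⊆S u∈T (_ , independent , comparable) =
    u∈T ,
    (λ a b a∈T b∈T → independent a b (T⊆S a∈T) (T⊆S b∈T)) ,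
    (λ a b a∈T b∈T ua ub → Comparable-⊆ T⊆S (comparable a b (T⊆S a∈T) (T⊆S b∈T) ua ub))

  -- Far from S ∖ T, u has the same neighbours in S as in T, and so do those neighbours.
  WeakSimplicial-extend : ∀ {S T u} → T ⊆ S → (∀ {x} → x ∈ S → x ∉ T → ¬ Dist12 G x u) →
    WeakSimplicial G T u → WeakSimplicial G S u
  WeakSimplicial-extend {S} {T} {u} T⊆S far (u∈T , independent , comparable) =
    T⊆S u∈T ,
    (λ a b a∈S b∈S ua ub → independent a b (inT a∈S ua) (inT b∈S ub) ua ub) ,
    (λ a b a∈S b∈S ua ub → lift ua ub (comparable a b (inT a∈S ua) (inT b∈S ub) ua ub))
    where
    u≢outside : ∀ {x} → x ∉ T → u ≢ x
    u≢outside x∉T refl = x∉T u∈T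
    inT : ∀ {a} → a ∈ S → Adj G u a → a ∈ T
    inT {a} a∈S ua with a ∈? T
    ... | yes a∈T = a∈T
    ... | no  a∉T = ⊥-elim (far a∈S a∉T (inj₁ (Adj-sym ua)))
    liftNbSub : ∀ {a b} → Adj G u a → NbSub G T a b → NbSub G S a b
    liftNbSub {a} ua a≤b x x∈S ax with x ∈? T
    ... | yes x∈T = a≤b x x∈T ax
    ... | no  x∉T = ⊥-elim (far x∈S x∉T
          (inj₂ (u≢outside x∉T , (λ xu → far x∈S x∉T (inj₁ xu)) , a , Adj-sym ax , Adj-sym ua)))
    lift : ∀ {a b} → Adj G u a → Adj G u b → Comparable G T a b → Comparable G S a b
    lift ua ub (inj₁ a≤b) = inj₁ (liftNbSub ua a≤b)
    lift ua ub (inj₂ b≤a) = inj₂ (liftNbSub ub b≤a)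

lemma7 : {n : ℕ} (G : Graph n) (X Y : Subset n) (v : Fin n) →
    IsSolution G X → IsSolution G Y → X ≡ Y - v → IsPV G Y v →
    ∀ u → WeakSimplicial G Y u ⇔ ((WeakSimplicial G X u × ¬ DelWS G X v u) ⊎ u ≡ v)
lemma7 G X Y v _ _ refl (v∈WSY , _) u = mk⇔ to from
  where
  Y⊆X∪v : Y ⊆ X ∪ ⁅ v ⁆
  Y⊆X∪v = p⊆p-x∪⁅x⁆ Y v
  X∪v⊆Y : X ∪ ⁅ v ⁆ ⊆ Y
  X∪v⊆Y = x∈p⇒p-x∪⁅x⁆⊆p (proj₁ v∈WSY)
  X⊆Y : X ⊆ Y
  X⊆Y = p─q⊆p Y ⁅ v ⁆

  to : WeakSimplicial G Y u → (WeakSimplicial G X u × ¬ DelWS G X v u) ⊎ u ≡ v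
  to u∈WSY with u ≟ v
  ... | yes u≡v = inj₂ u≡v
  ... | no  u≢v = inj₁ (WeakSimplicial-⊆ G X⊆Y (x∈p∧x≢y⇒x∈p-y u∈Y u≢v) u∈WSY ,
                        λ (_ , _ , u∉WSX∪v) → u∉WSX∪v (WeakSimplicial-⊆ G X∪v⊆Y (Y⊆X∪v u∈Y) u∈WSY))
    where u∈Y = proj₁ u∈WSY

  from : (WeakSimplicial G X u × ¬ DelWS G X v u) ⊎ u ≡ v → WeakSimplicial G Y u
  from (inj₂ refl) = v∈WSY
  -- ¬ DelWS only refutes ¬ WS(Y) near v; decidability of WS removes the double negation.
  from (inj₁ (u∈WSX , u∉Del)) = decidable-stable (weakSimplicial? G Y u) λ u∉WSY →
    let v-far : ¬ Dist12 G v u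
        v-far near = u∉Del (near , u∈WSX , λ u∈WSX∪v →
          u∉WSY (WeakSimplicial-⊆ G Y⊆X∪v (X∪v⊆Y (proj₁ u∈WSX∪v)) u∈WSX∪v))
    in u∉WSY (WeakSimplicial-extend G X⊆Y
         (λ x∈Y x∉X → subst (λ x → ¬ Dist12 G x u) (sym (x∈p∧x∉p-y⇒x≡y x∈Y x∉X)) v-far)
         u∈WSX)
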